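{- Let $N \geq 5$ be an integer and let $M$ be an integer with $0 \leq M \leq \binom{N}{2}$. Then there is no (simple) graph $G$ with exactly $N$ edges whose line graph $L(G)$ has exactly $M$ edges if and only if there exists an integer $t$ with \[1 \leq t < \frac{ -5+\sqrt{8N+17}}{2}\] such that \[\binom{N-t}{2}+\binom{t+2}{2} \;\leq\; M \;\leq\; \binom{N-t+1}{2}-1 .\] (Thus the largest such $t$ is $\left\lfloor \frac{ -5+\sqrt{8N+17}}{2}\right\rfloor$ if $\frac{ -5+\sqrt{8N+17}}{2}$ is not an integer, and $\frac{ -5+\sqrt{8N+17}}{2}-1$ if it is an integer.)
   Context: All graphs are finite and simple. For a graph $G$, the line graph $L(G)$ has the edges of $G$ as vertices, two being adjacent when they share an endpoint; hence $L(G)$ has $e(G)$ vertices and $\sum_{v}\binom{\deg(v)}{2}$ edges. A pair $(N,M)$ is called feasible (for line graphs) if some line graph has exactly $N$ vertices and $M$ edges, i.e. some graph $G$ has $e(G)=N$ and $e(L(G))=M$; otherwise it is non-feasible. The theorem describes exactly the non-feasible pairs. -}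

module Defs where

open import Data.Bool using (Bool; true; false; if_then_else_; _∨_)
open import Data.Nat using (ℕ; zero; suc; _+_; _*_; _∸_; _≤_; _<_)
open import Data.Nat.Combinatorics using (_C_)
open import Data.Fin using (Fin; toℕ)
open import Data.Fin.Properties using (_≟_)
open import Data.List using (List; []; _∷_; length; filter; map; concatMap; allFin)
open import Data.Product using (Σ; _×_; _,_; ∃-syntax)
open import Relation.Binary.PropositionalEquality using (_≡_)
open import Relation.Nullary.Decidable using (⌊_⌋)
open import Data.Nat.Properties using (_<?_)

record Graph (n : ℕ) : Set where
  field
    adj    : Fin n → Fin n → Bool
    symm   : ∀ i j → adj i j ≡ adj j i
    irrefl : ∀ i → adj i i ≡ false
open Graph public

orderedPairs : (n : ℕ) → List (Fin n × Fin n)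
orderedPairs n =
  concatMap (λ i → map (λ j → (i , j)) (filter (λ j → toℕ i <? toℕ j) (allFin n))) (allFin n)

edges : ∀ {n} → Graph n → List (Fin n × Fin n)
edges {n} G = filter (λ p → adj G (Data.Product.proj₁ p) (Data.Product.proj₂ p) Data.Bool.≟ true) (orderedPairs n)

-- Number of edges e(G) = number of vertices of L(G).
e : ∀ {n} → Graph n → ℕ
e G = length (edges G)

shareEndpoint : ∀ {n} → Fin n × Fin n → Fin n × Fin n → Bool
shareEndpoint (a , b) (c , d) =
  ⌊ a ≟ c ⌋ ∨ ⌊ a ≟ d ⌋ ∨ ⌊ b ≟ c ⌋ ∨ ⌊ b ≟ d ⌋

countTrue : ∀ {A : Set} → (A → Bool) → List A → ℕ
countTrue P [] = 0
countTrue P (x ∷ xs) = (if P x then 1 else 0) + countTrue P xs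

pairCount : ∀ {A : Set} → (A → A → Bool) → List A → ℕ
pairCount R [] = 0
pairCount R (x ∷ xs) = countTrue (R x) xs + pairCount R xs

-- Number of edges of the line graph L(G): unordered pairs of distinct edges of G
-- sharing an endpoint (edges G has no repetitions).
eL : ∀ {n} → Graph n → ℕ
eL G = pairCount shareEndpoint (edges G)

Feasible : ℕ → ℕ → Set
Feasible N M = ∃[ n ] Σ (Graph n) (λ G → (e G ≡ N) × (eL G ≡ M))

-- t < (-5 + sqrt(8N+17))/2, for natural t, is equivalent to (2t+5)^2 < 8N+17
-- (both sides of 2t+5 < sqrt(8N+17) are nonnegative).
tBound : ℕ → ℕ → Set
tBound N t = (2 * t + 5) * (2 * t + 5) < 8 * N + 17

-- C(N-t,2) + C(t+2,2) ≤ M ≤ C(N-t+1,2) - 1   (the "- 1" written as M + 1 ≤ …)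
inGap : ℕ → ℕ → ℕ → Set
inGap N M t = ((N ∸ t) C 2 + (t + 2) C 2 ≤ M) × (M + 1 ≤ (N ∸ t + 1) C 2)

{-# OPTIONS --safe #-}
-- The number of edges of L(G) is M = Σ_v C(deg v, 2). If D is the maximum degree of a
-- graph with N edges then C(D,2) ≤ M ≤ C(D,2) + C(N−D,2) + 2(N−D) (the N − D edges away
-- from a vertex of degree D meet at most two of its edges each), and Σ deg² ≤ D Σ deg.
-- For M in the t-th gap these bounds leave no room for D: D > N − t is too large,
-- t + 2 ≤ D ≤ N − t makes the upper bound too small, and D ≤ t + 1 violates the second
-- inequality. Conversely write M = C(D,2) + r with r < D and N = D + t. If r ≤ C(t,2) + 2t,
-- a hub of degree D joined to some vertices of a matching, or of a matching and a star,
-- realises (N, M); otherwise M lies in the t-th gap.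
module Submission where

open import Defs
open import Data.Bool using (Bool; true; false; if_then_else_; _∨_)
open import Data.Bool.Properties using () renaming (_≟_ to _≟ᵇ_)
open import Data.Empty using (⊥; ⊥-elim)
open import Data.Fin using (Fin; toℕ; punchIn; punchOut) renaming (zero to fzero; suc to fsuc)
open import Data.Fin.Properties using (_≟_; punchInᵢ≢i; punchIn-punchOut)
open import Data.List using (List; []; _∷_; _++_; length; filter; map; concat; allFin; tabulate)
open import Data.List.Properties using (map-++; length-++; length-map; map-tabulate; filter-++; filter-≐; map-∘)
open import Data.Nat using (ℕ; zero; suc; _+_; _*_; _∸_; _≤_; _<_; z≤n; s≤s)
open import Data.Nat.Combinatorics using (_C_; nCk+nC[k+1]≡[n+1]C[k+1]; nC1≡n)
open import Data.Nat.ListAction using () renaming (sum to sumᴸ)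
open import Data.Nat.Properties hiding (_≟_)
open import Data.Nat.Tactic.RingSolver using (solve-∀)
open import Data.Product using (Σ; ∃-syntax; _×_; _,_; proj₁; proj₂)
open import Data.Vec using (Vec; []; _∷_; lookup; replicate) renaming (_++_ to _++ᵛ_)
open import Function using (_∘_; id)
open import Function.Bundles using (_⇔_; mk⇔)
open import Relation.Binary.PropositionalEquality
open import Relation.Nullary using (¬_)
open import Relation.Nullary.Decidable using (Dec; ⌊_⌋; does; yes; no)
open import Relation.Unary using (Pred; Decidable)
open import Algebra.Properties.Semiring.Sum +-*-semiring using (sum; sum-cong-≗; ∑-distrib-+; sum-remove; *-distribʳ-sum)

-- Triangular numbers and finite sums

tri : ℕ → ℕ
tri zero = 0
tri (suc n) = tri n + n

nC2≡tri : ∀ n → n C 2 ≡ tri n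
nC2≡tri zero = refl
nC2≡tri (suc n) = begin
  suc n C 2     ≡⟨ sym (nCk+nC[k+1]≡[n+1]C[k+1] n 1) ⟩
  n C 1 + n C 2 ≡⟨ cong₂ _+_ (nC1≡n n) (nC2≡tri n) ⟩
  n + tri n     ≡⟨ +-comm n (tri n) ⟩
  tri (suc n)   ∎
  where open ≡-Reasoning

tri-+ : ∀ m n → tri (m + n) ≡ tri m + tri n + m * n
tri-+ zero n = sym (+-identityʳ (tri n))
tri-+ (suc m) n rewrite tri-+ m n = lemma (tri m) (tri n) m n
  where
  lemma : ∀ a b m n → a + b + m * n + (m + n) ≡ a + m + b + (n + m * n)
  lemma = solve-∀

tri-+1 : ∀ n → tri (n + 1) ≡ tri n + n
tri-+1 n = cong tri (+-comm n 1)

tri-+2 : ∀ n → tri (n + 2) ≡ tri n + n + n + 1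
tri-+2 n = trans (cong tri (+-comm n 2)) (lemma (tri n) n)
  where
  lemma : ∀ a n → a + n + suc n ≡ a + n + n + 1
  lemma = solve-∀

tri+tri+n≡n*n : ∀ n → tri n + tri n + n ≡ n * n
tri+tri+n≡n*n zero = refl
tri+tri+n≡n*n (suc n) = begin
  tri n + n + (tri n + n) + suc n ≡⟨ lemma₁ (tri n) n ⟩
  tri n + tri n + n + n + n + 1   ≡⟨ cong (λ x → x + n + n + 1) (tri+tri+n≡n*n n) ⟩
  n * n + n + n + 1               ≡⟨ lemma₂ n ⟩
  suc n * suc n                   ∎
  where
  open ≡-Reasoning
  lemma₁ : ∀ a n → a + n + (a + n) + suc n ≡ a + a + n + n + n + 1
  lemma₁ = solve-∀
  lemma₂ : ∀ n → n * n + n + n + 1 ≡ suc n * suc n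
  lemma₂ = solve-∀

tri-mono-≤ : ∀ {m n} → m ≤ n → tri m ≤ tri n
tri-mono-≤ z≤n = z≤n
tri-mono-≤ (s≤s m≤n) = +-mono-≤ (tri-mono-≤ m≤n) m≤n

bit : Bool → ℕ
bit true = 1
bit false = 0

count : ∀ {n} → (Fin n → Bool) → ℕ
count S = sum (λ j → bit (S j))

sumOver : ∀ {n} → (Fin n → Bool) → (Fin n → ℕ) → ℕ
sumOver S f = sum (λ j → if S j then f j else 0)

≤-sum : ∀ {n} (f : Fin (suc n) → ℕ) i → f i ≤ sum f
≤-sum f i = ≤-trans (m≤m+n (f i) _) (≤-reflexive (sym (sum-remove {i = i} f)))

sumOver-cong : ∀ {n} (S : Fin n → Bool) {f g : Fin n → ℕ} → (∀ j → f j ≡ g j) → sumOver S f ≡ sumOver S g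
sumOver-cong S f≗g = sum-cong-≗ (λ j → cong (λ x → if S j then x else 0) (f≗g j))

sum-mono-≤ : ∀ {n} {f g : Fin n → ℕ} → (∀ j → f j ≤ g j) → sum f ≤ sum g
sum-mono-≤ {zero} f≤g = z≤n
sum-mono-≤ {suc n} f≤g = +-mono-≤ (f≤g fzero) (sum-mono-≤ (λ j → f≤g (fsuc j)))

sumOver≤sum : ∀ {n} (S : Fin n → Bool) (f : Fin n → ℕ) → sumOver S f ≤ sum f
sumOver≤sum S f = sum-mono-≤ pointwise
  where
  pointwise : ∀ j → (if S j then f j else 0) ≤ f j
  pointwise j with S j
  ... | true = ≤-refl
  ... | false = z≤n

sumOver≤count* : ∀ {n} (S : Fin n → Bool) (f : Fin n → ℕ) {B} →
  (∀ j → S j ≡ true → f j ≤ B) → sumOver S f ≤ count S * B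
sumOver≤count* {zero} S f f≤B = z≤n
sumOver≤count* {suc n} S f f≤B with S fzero in S0
... | true = +-mono-≤ (f≤B fzero S0) (sumOver≤count* (λ j → S (fsuc j)) (λ j → f (fsuc j)) (λ j → f≤B (fsuc j)))
... | false = sumOver≤count* (λ j → S (fsuc j)) (λ j → f (fsuc j)) (λ j → f≤B (fsuc j))

bit≤1 : ∀ b → bit b ≤ 1
bit≤1 true = ≤-refl
bit≤1 false = z≤n

count-remove : ∀ {n} (S : Fin (suc n) → Bool) i → count S ≡ bit (S i) + count (λ j → S (punchIn i j))
count-remove S i = sum-remove {i = i} (λ j → bit (S j))

bit≤count : ∀ {n} (S : Fin n → Bool) i → bit (S i) ≤ count S
bit≤count {suc n} S i = ≤-trans (m≤m+n _ _) (≤-reflexive (sym (count-remove S i)))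

bit+bit≤count : ∀ {n} (S : Fin n → Bool) {i j} → ¬ i ≡ j → bit (S i) + bit (S j) ≤ count S
bit+bit≤count {suc n} S {i} {j} i≢j = begin
  bit (S i) + bit (S j)                          ≡⟨ cong (λ k → bit (S i) + bit (S k)) (sym (punchIn-punchOut i≢j)) ⟩
  bit (S i) + bit (S (punchIn i (punchOut i≢j)))  ≤⟨ +-monoʳ-≤ (bit (S i)) (bit≤count (λ k → S (punchIn i k)) (punchOut i≢j)) ⟩
  bit (S i) + count (λ k → S (punchIn i k))        ≡⟨ sym (count-remove S i) ⟩
  count S                                        ∎
  where open ≤-Reasoning

sumOver≤member+count* : ∀ {n} (S : Fin n → Bool) (f : Fin n → ℕ) {B} i → S i ≡ true →
  (∀ j → ¬ i ≡ j → S j ≡ true → f j ≤ B) → ∃[ s ] (count S ≡ suc s × sumOver S f ≤ f i + s * B)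
sumOver≤member+count* {suc n} S f {B} i Si f≤B = count S′ , count-S , sum-S
  where
  S′ : Fin n → Bool
  S′ j = S (punchIn i j)
  f′ : Fin n → ℕ
  f′ j = f (punchIn i j)
  count-S : count S ≡ suc (count S′)
  count-S = trans (count-remove S i) (cong (λ b → bit b + count S′) Si)
  sum-S : sumOver S f ≤ f i + count S′ * B
  sum-S = begin
    sumOver S f                                ≡⟨ sum-remove {i = i} (λ j → if S j then f j else 0) ⟩
    (if S i then f i else 0) + sumOver S′ f′   ≡⟨ cong (λ b → (if b then f i else 0) + sumOver S′ f′) Si ⟩
    f i + sumOver S′ f′                        ≤⟨ +-monoʳ-≤ (f i) (sumOver≤count* S′ f′ (λ j → f≤B (punchIn i j) (punchInᵢ≢i i j ∘ sym))) ⟩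
    f i + count S′ * B                         ∎
    where open ≤-Reasoning

filter-map : ∀ {a b p q} {A : Set a} {B : Set b} {P : Pred B p} {Q : Pred A q}
  (P? : Decidable P) (Q? : Decidable Q) (f : A → B) →
  (∀ x → does (P? (f x)) ≡ does (Q? x)) → ∀ xs → filter P? (map f xs) ≡ map f (filter Q? xs)
filter-map P? Q? f same [] = refl
filter-map P? Q? f same (x ∷ xs) rewrite same x with does (Q? x)
... | true = cong (f x ∷_) (filter-map P? Q? f same xs)
... | false = filter-map P? Q? f same xs

countTrue-++ : ∀ {A : Set} (P : A → Bool) xs ys → countTrue P (xs ++ ys) ≡ countTrue P xs + countTrue P ys
countTrue-++ P [] ys = refl
countTrue-++ P (x ∷ xs) ys rewrite countTrue-++ P xs ys = sym (+-assoc (if P x then 1 else 0) _ _)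

countTrue-map : ∀ {A B : Set} (f : A → B) {P : B → Bool} {Q : A → Bool} →
  (∀ x → P (f x) ≡ Q x) → ∀ xs → countTrue P (map f xs) ≡ countTrue Q xs
countTrue-map f same [] = refl
countTrue-map f {Q = Q} same (x ∷ xs) rewrite same x = cong ((if Q x then 1 else 0) +_) (countTrue-map f same xs)

countTrue-true : ∀ {A : Set} (xs : List A) → countTrue (λ _ → true) xs ≡ length xs
countTrue-true [] = refl
countTrue-true (x ∷ xs) = cong suc (countTrue-true xs)

countTrue-false : ∀ {A : Set} (xs : List A) → countTrue (λ _ → false) xs ≡ 0
countTrue-false [] = refl
countTrue-false (x ∷ xs) = countTrue-false xs

crossCount : ∀ {A : Set} → (A → A → Bool) → List A → List A → ℕ
crossCount R [] ys = 0
crossCount R (x ∷ xs) ys = countTrue (R x) ys + crossCount R xs ys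

pairCount-++ : ∀ {A : Set} (R : A → A → Bool) xs ys →
  pairCount R (xs ++ ys) ≡ pairCount R xs + pairCount R ys + crossCount R xs ys
pairCount-++ R [] ys = sym (+-identityʳ _)
pairCount-++ R (x ∷ xs) ys rewrite countTrue-++ (R x) xs ys | pairCount-++ R xs ys =
  lemma (countTrue (R x) xs) (countTrue (R x) ys) (pairCount R xs) (pairCount R ys) (crossCount R xs ys)
  where
  lemma : ∀ a b c d e → a + b + (c + d + e) ≡ a + c + d + (b + e)
  lemma = solve-∀

-- Graphs built one vertex at a time

≟-suc : ∀ {n} (a c : Fin n) → ⌊ fsuc a ≟ fsuc c ⌋ ≡ ⌊ a ≟ c ⌋
≟-suc a c with a ≟ c
... | yes _ = refl
... | no _ = refl

Pair : ℕ → Set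
Pair n = Fin n × Fin n

liftPair : ∀ {n} → Pair n → Pair (suc n)
liftPair (a , b) = fsuc a , fsuc b

spoke : ∀ {n} → Fin n → Pair (suc n)
spoke j = fzero , fsuc j

tabulate-suc : ∀ {n} → tabulate {n = n} fsuc ≡ map fsuc (allFin n)
tabulate-suc = sym (map-tabulate id fsuc)

pairsFrom : ∀ n → Fin n → List (Pair n)
pairsFrom n i = map (i ,_) (filter (λ j → toℕ i <? toℕ j) (allFin n))

pairsFrom-suc : ∀ n i → pairsFrom (suc n) (fsuc i) ≡ map liftPair (pairsFrom n i)
pairsFrom-suc n i = begin
  map (fsuc i ,_) (filter (λ j → toℕ (fsuc i) <? toℕ j) (tabulate fsuc))
    ≡⟨ cong (map (fsuc i ,_) ∘ filter (λ j → toℕ (fsuc i) <? toℕ j)) tabulate-suc ⟩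
  map (fsuc i ,_) (filter (λ j → toℕ (fsuc i) <? toℕ j) (map fsuc (allFin n)))
    ≡⟨ cong (map (fsuc i ,_)) (filter-map _ (λ j → toℕ i <? toℕ j) fsuc (λ _ → refl) (allFin n)) ⟩
  map (fsuc i ,_) (map fsuc (filter (λ j → toℕ i <? toℕ j) (allFin n)))
    ≡⟨ sym (map-∘ _) ⟩
  map (liftPair ∘ (i ,_)) (filter (λ j → toℕ i <? toℕ j) (allFin n))
    ≡⟨ map-∘ _ ⟩
  map liftPair (pairsFrom n i) ∎
  where open ≡-Reasoning

pairsFrom-zero : ∀ n → pairsFrom (suc n) fzero ≡ map spoke (allFin n)
pairsFrom-zero n = begin
  map (fzero ,_) (filter (λ j → 0 <? toℕ j) (tabulate fsuc))
    ≡⟨ cong (map (fzero ,_) ∘ filter (λ j → 0 <? toℕ j)) tabulate-suc ⟩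
  map (fzero ,_) (filter (λ j → 0 <? toℕ j) (map fsuc (allFin n)))
    ≡⟨ cong (map (fzero ,_)) (filter-positive (allFin n)) ⟩
  map (fzero ,_) (map fsuc (allFin n))
    ≡⟨ sym (map-∘ _) ⟩
  map spoke (allFin n) ∎
  where
  open ≡-Reasoning
  filter-positive : ∀ (js : List (Fin n)) → filter (λ j → 0 <? toℕ j) (map fsuc js) ≡ map fsuc js
  filter-positive [] = refl
  filter-positive (j ∷ js) = cong (fsuc j ∷_) (filter-positive js)

orderedPairs-suc : ∀ n → orderedPairs (suc n) ≡ map spoke (allFin n) ++ map liftPair (orderedPairs n)
orderedPairs-suc n = cong₂ _++_ (pairsFrom-zero n)
  (trans (cong (concat ∘ map (pairsFrom (suc n))) tabulate-suc) (lifted (allFin n)))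
  where
  lifted : ∀ is → concat (map (pairsFrom (suc n)) (map fsuc is)) ≡ map liftPair (concat (map (pairsFrom n) is))
  lifted [] = refl
  lifted (i ∷ is) = trans (cong₂ _++_ (pairsFrom-suc n i) (lifted is)) (sym (map-++ liftPair (pairsFrom n i) _))

extendAdj : ∀ {n} → Graph n → (Fin n → Bool) → Fin (suc n) → Fin (suc n) → Bool
extendAdj G S fzero fzero = false
extendAdj G S fzero (fsuc j) = S j
extendAdj G S (fsuc i) fzero = S i
extendAdj G S (fsuc i) (fsuc j) = adj G i j

extendAdj-symm : ∀ {n} (G : Graph n) S i j → extendAdj G S i j ≡ extendAdj G S j i
extendAdj-symm G S fzero fzero = refl
extendAdj-symm G S fzero (fsuc j) = refl
extendAdj-symm G S (fsuc i) fzero = refl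
extendAdj-symm G S (fsuc i) (fsuc j) = symm G i j

extendAdj-irrefl : ∀ {n} (G : Graph n) S i → extendAdj G S i i ≡ false
extendAdj-irrefl G S fzero = refl
extendAdj-irrefl G S (fsuc i) = irrefl G i

extend : ∀ {n} → Graph n → (Fin n → Bool) → Graph (suc n)
extend G S = record { adj = extendAdj G S ; symm = extendAdj-symm G S ; irrefl = extendAdj-irrefl G S }

members : ∀ {n} → (Fin n → Bool) → List (Fin n)
members {n} S = filter (λ j → S j ≟ᵇ true) (allFin n)

edges-extend : ∀ {n} (G : Graph n) S → edges (extend G S) ≡ map spoke (members S) ++ map liftPair (edges G)
edges-extend {n} G S = begin
  filter A? (orderedPairs (suc n))
    ≡⟨ cong (filter A?) (orderedPairs-suc n) ⟩
  filter A? (map spoke (allFin n) ++ map liftPair (orderedPairs n))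
    ≡⟨ filter-++ A? (map spoke (allFin n)) _ ⟩
  filter A? (map spoke (allFin n)) ++ filter A? (map liftPair (orderedPairs n))
    ≡⟨ cong₂ _++_ (filter-map A? _ spoke (λ _ → refl) (allFin n)) (filter-map A? _ liftPair (λ _ → refl) (orderedPairs n)) ⟩
  map spoke (members S) ++ map liftPair (edges G) ∎
  where
  open ≡-Reasoning
  A? : (p : Pair (suc n)) → Dec (extendAdj G S (proj₁ p) (proj₂ p) ≡ true)
  A? p = extendAdj G S (proj₁ p) (proj₂ p) ≟ᵇ true

members-tail : ∀ {n} (S : Fin (suc n) → Bool) →
  filter (λ j → S j ≟ᵇ true) (tabulate fsuc) ≡ map fsuc (members (S ∘ fsuc))
members-tail {n} S = trans (cong (filter (λ j → S j ≟ᵇ true)) tabulate-suc)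
  (filter-map (λ j → S j ≟ᵇ true) (λ j → S (fsuc j) ≟ᵇ true) fsuc (λ _ → refl) (allFin n))

length-members : ∀ {n} (S : Fin n → Bool) → length (members S) ≡ count S
length-members {zero} S = refl
length-members {suc n} S with S fzero | members-tail S
... | true | tail = cong suc (trans (cong length tail) (trans (length-map fsuc (members (S ∘ fsuc))) (length-members (S ∘ fsuc))))
... | false | tail = trans (cong length tail) (trans (length-map fsuc (members (S ∘ fsuc))) (length-members (S ∘ fsuc)))

sum-members : ∀ {n} (S : Fin n → Bool) (f : Fin n → ℕ) → sumᴸ (map f (members S)) ≡ sumOver S f
sum-members-tail : ∀ {n} (S : Fin (suc n) → Bool) (f : Fin (suc n) → ℕ) {ms} →
  ms ≡ map fsuc (members (S ∘ fsuc)) → sumᴸ (map f ms) ≡ sumOver (S ∘ fsuc) (f ∘ fsuc)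

sum-members {zero} S f = refl
sum-members {suc n} S f with S fzero | members-tail S
... | true | tail = cong (f fzero +_) (sum-members-tail S f tail)
... | false | tail = sum-members-tail S f tail

sum-members-tail S f refl =
  trans (cong sumᴸ (sym (map-∘ {g = f} (members (S ∘ fsuc))))) (sum-members (S ∘ fsuc) (f ∘ fsuc))

countTrue-≟zero-lifted : ∀ {n} (ms : List (Fin n)) → countTrue (λ k → ⌊ fzero ≟ k ⌋) (map fsuc ms) ≡ 0
countTrue-≟zero-lifted ms = trans (countTrue-map fsuc {Q = λ _ → false} (λ _ → refl) ms) (countTrue-false ms)

countTrue-≟suc-lifted : ∀ {n} (j : Fin n) ms →
  countTrue (λ k → ⌊ fsuc j ≟ k ⌋) (map fsuc ms) ≡ countTrue (λ k → ⌊ j ≟ k ⌋) ms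
countTrue-≟suc-lifted j = countTrue-map fsuc (≟-suc j)

isMember-count : ∀ {n} (S : Fin n → Bool) j → countTrue (λ k → ⌊ j ≟ k ⌋) (members S) ≡ bit (S j)
isMember-count {suc n} S fzero with S fzero | members-tail S
... | true | tail = cong suc (trans (cong (countTrue _) tail) (countTrue-≟zero-lifted (members (S ∘ fsuc))))
... | false | tail = trans (cong (countTrue _) tail) (countTrue-≟zero-lifted (members (S ∘ fsuc)))
isMember-count {suc n} S (fsuc j) with S fzero | members-tail S
... | true | tail = trans (cong (countTrue _) tail) (trans (countTrue-≟suc-lifted j (members (S ∘ fsuc))) (isMember-count (S ∘ fsuc) j))
... | false | tail = trans (cong (countTrue _) tail) (trans (countTrue-≟suc-lifted j (members (S ∘ fsuc))) (isMember-count (S ∘ fsuc) j))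

incident : ∀ {n} → Fin n → Pair n → Bool
incident j (a , b) = ⌊ j ≟ a ⌋ ∨ ⌊ j ≟ b ⌋

degree : ∀ {n} → Graph n → Fin n → ℕ
degree G j = countTrue (incident j) (edges G)

pairCount-spokes : ∀ {n} (js : List (Fin n)) → pairCount shareEndpoint (map spoke js) ≡ tri (length js)
pairCount-spokes [] = refl
pairCount-spokes (j ∷ js) = trans
  (cong₂ _+_ (trans (countTrue-map spoke {P = shareEndpoint (spoke j)} {Q = λ _ → true} (λ _ → refl) js) (countTrue-true js))
             (pairCount-spokes js))
  (+-comm (length js) (tri (length js)))

shareEndpoint-lift : ∀ {n} (p q : Pair n) → shareEndpoint (liftPair p) (liftPair q) ≡ shareEndpoint p q
shareEndpoint-lift (a , b) (c , d) rewrite ≟-suc a c | ≟-suc a d | ≟-suc b c | ≟-suc b d = refl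

pairCount-lift : ∀ {n} (E : List (Pair n)) → pairCount shareEndpoint (map liftPair E) ≡ pairCount shareEndpoint E
pairCount-lift [] = refl
pairCount-lift (p ∷ E) = cong₂ _+_ (countTrue-map liftPair (shareEndpoint-lift p) E) (pairCount-lift E)

crossCount-spokes : ∀ {n} (js : List (Fin n)) (E : List (Pair n)) →
  crossCount shareEndpoint (map spoke js) (map liftPair E) ≡ sumᴸ (map (λ j → countTrue (incident j) E) js)
crossCount-spokes [] E = refl
crossCount-spokes (j ∷ js) E =
  cong₂ _+_ (countTrue-map liftPair (λ { (c , d) → cong₂ _∨_ (≟-suc j c) (≟-suc j d) }) E) (crossCount-spokes js E)

e-extend : ∀ {n} (G : Graph n) S → e (extend G S) ≡ count S + e G
e-extend G S rewrite edges-extend G S | length-++ (map spoke (members S)) {map liftPair (edges G)}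
  | length-map spoke (members S) | length-map liftPair (edges G) | length-members S = refl

eL-extend : ∀ {n} (G : Graph n) S → eL (extend G S) ≡ tri (count S) + eL G + sumOver S (degree G)
eL-extend G S rewrite edges-extend G S | pairCount-++ shareEndpoint (map spoke (members S)) (map liftPair (edges G))
  | pairCount-spokes (members S) | pairCount-lift (edges G) | crossCount-spokes (members S) (edges G)
  | length-members S | sum-members S (degree G) = refl

degree-extend : ∀ {n} (G : Graph n) S v → degree (extend G S) v ≡
  countTrue (incident v) (map spoke (members S)) + countTrue (incident v) (map liftPair (edges G))
degree-extend G S v = trans (cong (countTrue (incident v)) (edges-extend G S)) (countTrue-++ (incident v) (map spoke (members S)) _)

degree-extend-zero : ∀ {n} (G : Graph n) S → degree (extend G S) fzero ≡ count S
degree-extend-zero G S = begin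
  degree (extend G S) fzero
    ≡⟨ degree-extend G S fzero ⟩
  countTrue (incident fzero) (map spoke (members S)) + countTrue (incident fzero) (map liftPair (edges G))
    ≡⟨ cong₂ _+_ (countTrue-map spoke {P = incident fzero} {Q = λ _ → true} (λ _ → refl) (members S))
                 (countTrue-map liftPair {P = incident fzero} {Q = λ _ → false} (λ _ → refl) (edges G)) ⟩
  countTrue (λ _ → true) (members S) + countTrue (λ _ → false) (edges G)
    ≡⟨ cong₂ _+_ (countTrue-true (members S)) (countTrue-false (edges G)) ⟩
  length (members S) + 0
    ≡⟨ trans (+-identityʳ _) (length-members S) ⟩
  count S ∎
  where open ≡-Reasoning

degree-extend-suc : ∀ {n} (G : Graph n) S j → degree (extend G S) (fsuc j) ≡ bit (S j) + degree G j
degree-extend-suc G S j = begin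
  degree (extend G S) (fsuc j)
    ≡⟨ degree-extend G S (fsuc j) ⟩
  countTrue (incident (fsuc j)) (map spoke (members S)) + countTrue (incident (fsuc j)) (map liftPair (edges G))
    ≡⟨ cong₂ _+_ (countTrue-map spoke {P = incident (fsuc j)} {Q = λ k → ⌊ j ≟ k ⌋} (≟-suc j) (members S))
                 (countTrue-map liftPair {P = incident (fsuc j)} {Q = incident j} (λ { (a , b) → cong₂ _∨_ (≟-suc j a) (≟-suc j b) }) (edges G)) ⟩
  countTrue (λ k → ⌊ j ≟ k ⌋) (members S) + degree G j
    ≡⟨ cong (_+ degree G j) (isMember-count S j) ⟩
  bit (S j) + degree G j ∎
  where open ≡-Reasoning

restrict : ∀ {n} → Graph (suc n) → Graph n
restrict G = record
  { adj = λ i j → adj G (fsuc i) (fsuc j)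
  ; symm = λ i j → symm G (fsuc i) (fsuc j)
  ; irrefl = λ i → irrefl G (fsuc i) }

neighboursOfZero : ∀ {n} → Graph (suc n) → Fin n → Bool
neighboursOfZero G j = adj G fzero (fsuc j)

extendAdj-restrict : ∀ {n} (G : Graph (suc n)) i j → extendAdj (restrict G) (neighboursOfZero G) i j ≡ adj G i j
extendAdj-restrict G fzero fzero = sym (irrefl G fzero)
extendAdj-restrict G fzero (fsuc j) = refl
extendAdj-restrict G (fsuc i) fzero = symm G fzero (fsuc i)
extendAdj-restrict G (fsuc i) (fsuc j) = refl

edges-extend-restrict : ∀ {n} (G : Graph (suc n)) → edges (extend (restrict G) (neighboursOfZero G)) ≡ edges G
edges-extend-restrict {n} G = filter-≐ (λ p → A′ p ≟ᵇ true) (λ p → adj G (proj₁ p) (proj₂ p) ≟ᵇ true)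
  ((λ {p} h → trans (sym (same p)) h) , (λ {p} h → trans (same p) h)) (orderedPairs (suc n))
  where
  A′ : Pair (suc n) → Bool
  A′ p = extendAdj (restrict G) (neighboursOfZero G) (proj₁ p) (proj₂ p)
  same : ∀ p → A′ p ≡ adj G (proj₁ p) (proj₂ p)
  same p = extendAdj-restrict G (proj₁ p) (proj₂ p)

-- Necessary conditions

-- C(D,2) pairs of edges at a vertex of degree D, at most C(N−D,2) among the other edges,
-- and each other edge meets at most two of the D edges at that vertex.
starBound : ℕ → ℕ → ℕ
starBound N D = tri D + tri (N ∸ D) + 2 * (N ∸ D)

-- degree+degree≤ and ≤tri are only needed to re-establish ≤starBound after adding a vertex.
record DegreeInvariants {n} (d : Fin n → ℕ) (N M : ℕ) : Set where
  field
    lineEdges : M ≡ sum (tri ∘ d)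
    handshake : sum d ≡ N + N
    degree≤edges : ∀ v → d v ≤ N
    degree+degree≤ : ∀ u v → ¬ u ≡ v → d u + d v ≤ suc N
    ≤starBound : ∀ u → M ≤ starBound N (d u)
    ≤tri : M ≤ tri N

emptyInvariants : (d : Fin 0 → ℕ) → DegreeInvariants d 0 0
emptyInvariants d = record
  { lineEdges = refl ; handshake = refl ; degree≤edges = λ () ; degree+degree≤ = λ ()
  ; ≤starBound = λ () ; ≤tri = z≤n }

extendDegrees : ∀ {n} → (Fin n → Bool) → (Fin n → ℕ) → Fin (suc n) → ℕ
extendDegrees S d fzero = count S
extendDegrees S d (fsuc j) = bit (S j) + d j

tri-bit+ : ∀ b x → tri (bit b + x) ≡ tri x + (if b then x else 0)
tri-bit+ true x = refl
tri-bit+ false x = sym (+-identityʳ _)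

module Extension {n} (S : Fin n → Bool) (d : Fin n → ℕ) {N M} (inv : DegreeInvariants d N M) where
  open DegreeInvariants inv

  s N′ M′ : ℕ
  s = count S
  N′ = s + N
  M′ = tri s + M + sumOver S d

  d′ : Fin (suc n) → ℕ
  d′ = extendDegrees S d

  lineEdges′ : M′ ≡ sum (tri ∘ d′)
  lineEdges′ = begin
    tri s + M + sumOver S d                                       ≡⟨ +-assoc (tri s) M _ ⟩
    tri s + (M + sumOver S d)                                     ≡⟨ cong (λ m → tri s + (m + sumOver S d)) lineEdges ⟩
    tri s + (sum (tri ∘ d) + sumOver S d)                         ≡⟨ cong (tri s +_) (sym (∑-distrib-+ (tri ∘ d) _)) ⟩
    tri s + sum (λ j → tri (d j) + (if S j then d j else 0))      ≡⟨ cong (tri s +_) (sum-cong-≗ (λ j → sym (tri-bit+ (S j) (d j)))) ⟩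
    sum (tri ∘ d′)                                                ∎
    where open ≡-Reasoning

  handshake′ : sum d′ ≡ N′ + N′
  handshake′ = begin
    s + sum (λ j → bit (S j) + d j) ≡⟨ cong (s +_) (∑-distrib-+ (bit ∘ S) d) ⟩
    s + (s + sum d)                 ≡⟨ cong (λ x → s + (s + x)) handshake ⟩
    s + (s + (N + N))               ≡⟨ lemma s N ⟩
    N′ + N′                         ∎
    where
    open ≡-Reasoning
    lemma : ∀ a b → a + (a + (b + b)) ≡ a + b + (a + b)
    lemma = solve-∀

  degree≤edges′ : ∀ v → d′ v ≤ N′
  degree≤edges′ fzero = m≤m+n s N
  degree≤edges′ (fsuc j) = +-mono-≤ (bit≤count S j) (degree≤edges j)

  degree+degree≤′ : ∀ u v → ¬ u ≡ v → d′ u + d′ v ≤ suc N′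
  degree+degree≤′ fzero fzero u≢v = ⊥-elim (u≢v refl)
  degree+degree≤′ fzero (fsuc j) _ = begin
    s + (bit (S j) + d j) ≤⟨ +-monoʳ-≤ s (+-mono-≤ (bit≤1 (S j)) (degree≤edges j)) ⟩
    s + suc N             ≡⟨ +-suc s N ⟩
    suc N′                ∎
    where open ≤-Reasoning
  degree+degree≤′ (fsuc i) fzero i≢0 = begin
    bit (S i) + d i + s ≡⟨ +-comm _ s ⟩
    s + (bit (S i) + d i) ≤⟨ degree+degree≤′ fzero (fsuc i) (λ ()) ⟩
    suc N′ ∎
    where open ≤-Reasoning
  degree+degree≤′ (fsuc i) (fsuc j) i≢j = begin
    bit (S i) + d i + (bit (S j) + d j)   ≡⟨ lemma (bit (S i)) (d i) (bit (S j)) (d j) ⟩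
    (bit (S i) + bit (S j)) + (d i + d j) ≤⟨ +-mono-≤ (bit+bit≤count S (i≢j ∘ cong fsuc)) (degree+degree≤ i j (i≢j ∘ cong fsuc)) ⟩
    s + suc N                             ≡⟨ +-suc s N ⟩
    suc N′                                ∎
    where
    open ≤-Reasoning
    lemma : ∀ a b c e → a + b + (c + e) ≡ (a + c) + (b + e)
    lemma = solve-∀

  ≤tri′ : M′ ≤ tri N′
  ≤tri′ = begin
    tri s + M + sumOver S d ≤⟨ +-mono-≤ (+-monoʳ-≤ (tri s) ≤tri) (sumOver≤count* S d (λ v _ → degree≤edges v)) ⟩
    tri s + tri N + s * N   ≡⟨ sym (tri-+ s N) ⟩
    tri N′                  ∎
    where open ≤-Reasoning

  rest : Fin n → ℕ
  rest i = N ∸ d i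

  neighbour-bound : ∀ i v → ¬ i ≡ v → d v ≤ suc (rest i)
  neighbour-bound i v i≢v = +-cancelˡ-≤ (d i) (d v) (suc (rest i)) (begin
    d i + d v          ≤⟨ degree+degree≤ i v i≢v ⟩
    suc N              ≡⟨ cong suc (sym (m+[n∸m]≡n (degree≤edges i))) ⟩
    suc (d i + rest i) ≡⟨ sym (+-suc (d i) (rest i)) ⟩
    d i + suc (rest i) ∎)
    where open ≤-Reasoning

  ≤starBound-new : M′ ≤ starBound N′ s
  ≤starBound-new = begin
    tri s + M + sumOver S d ≤⟨ +-mono-≤ (+-monoʳ-≤ (tri s) ≤tri) (≤-trans (sumOver≤sum S d) (≤-reflexive handshake)) ⟩
    tri s + tri N + (N + N) ≡⟨ cong (λ x → tri s + tri N + x) (cong (N +_) (sym (+-identityʳ N))) ⟩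
    tri s + tri N + 2 * N   ≡⟨ cong (λ x → tri s + tri x + 2 * x) (sym (m+n∸m≡n s N)) ⟩
    starBound N′ s          ∎
    where open ≤-Reasoning

  ≤starBound-nonmember : ∀ i → S i ≡ false → M′ ≤ starBound N′ (d i)
  ≤starBound-nonmember i Si = begin
    tri s + M + sumOver S d
      ≤⟨ +-mono-≤ (+-monoʳ-≤ (tri s) (≤starBound i)) (sumOver≤count* S d (λ v Sv → neighbour-bound i v (i≢v Sv))) ⟩
    tri s + (tri δ + tri a + 2 * a) + s * suc a
      ≤⟨ ≤-trans (m≤m+n _ s) (≤-reflexive (lemma (tri s) (tri δ) (tri a) s a)) ⟩
    tri δ + (tri s + tri a + s * a) + 2 * (s + a)
      ≡⟨ cong (λ x → tri δ + x + 2 * (s + a)) (sym (tri-+ s a)) ⟩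
    tri δ + tri (s + a) + 2 * (s + a)
      ≡⟨ cong (λ x → tri δ + tri x + 2 * x) (sym (+-∸-assoc s (degree≤edges i))) ⟩
    starBound N′ δ ∎
    where
    open ≤-Reasoning
    δ a : ℕ
    δ = d i
    a = rest i
    i≢v : ∀ {v} → S v ≡ true → ¬ i ≡ v
    i≢v Sv refl with trans (sym Si) Sv
    ... | ()
    lemma : ∀ ts td ta s a → ts + (td + ta + 2 * a) + s * suc a + s ≡ td + (ts + ta + s * a) + 2 * (s + a)
    lemma = solve-∀

  ≤starBound-member : ∀ i → S i ≡ true → M′ ≤ starBound N′ (suc (d i))
  ≤starBound-member i Si with sumOver≤member+count* S d {suc (rest i)} i Si (λ v i≢v _ → neighbour-bound i v i≢v)
  ... | s′ , s≡1+s′ , Σ≤ = begin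
    tri s + M + sumOver S d
      ≤⟨ +-mono-≤ (+-monoʳ-≤ (tri s) (≤starBound i)) Σ≤ ⟩
    tri s + (tri δ + tri a + 2 * a) + (δ + s′ * suc a)
      ≡⟨ cong (λ x → tri x + (tri δ + tri a + 2 * a) + (δ + s′ * suc a)) s≡1+s′ ⟩
    tri (suc s′) + (tri δ + tri a + 2 * a) + (δ + s′ * suc a)
      ≡⟨ lemma (tri s′) (tri δ) (tri a) s′ δ a ⟩
    tri (suc δ) + (tri s′ + tri a + s′ * a) + 2 * (s′ + a)
      ≡⟨ cong (λ x → tri (suc δ) + x + 2 * (s′ + a)) (sym (tri-+ s′ a)) ⟩
    tri (suc δ) + tri (s′ + a) + 2 * (s′ + a)
      ≡⟨ cong (λ x → tri (suc δ) + tri x + 2 * x) (sym N′∸suc-δ) ⟩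
    starBound N′ (suc δ) ∎
    where
    open ≤-Reasoning
    δ a : ℕ
    δ = d i
    a = rest i
    N′∸suc-δ : N′ ∸ suc δ ≡ s′ + a
    N′∸suc-δ = trans (cong (λ x → (x + N) ∸ suc δ) s≡1+s′) (+-∸-assoc s′ (degree≤edges i))
    lemma : ∀ ts td ta s δ a → ts + s + (td + ta + 2 * a) + (δ + s * suc a) ≡ td + δ + (ts + ta + s * a) + 2 * (s + a)
    lemma = solve-∀

  ≤starBound′ : ∀ u → M′ ≤ starBound N′ (d′ u)
  ≤starBound′ fzero = ≤starBound-new
  ≤starBound′ (fsuc i) with S i in Si
  ... | true = ≤starBound-member i Si
  ... | false = ≤starBound-nonmember i Si

  invariants : DegreeInvariants d′ N′ M′
  invariants = record
    { lineEdges = lineEdges′ ; handshake = handshake′ ; degree≤edges = degree≤edges′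
    ; degree+degree≤ = degree+degree≤′ ; ≤starBound = ≤starBound′ ; ≤tri = ≤tri′ }

invariants-cong : ∀ {n} {d d′ : Fin n → ℕ} {N N′ M M′} → (∀ v → d v ≡ d′ v) → N ≡ N′ → M ≡ M′ →
  DegreeInvariants d N M → DegreeInvariants d′ N′ M′
invariants-cong {d = d} {d′} {N} {M = M} d≗d′ refl refl inv = record
  { lineEdges = trans lineEdges (sum-cong-≗ (cong tri ∘ d≗d′))
  ; handshake = trans (sym (sum-cong-≗ d≗d′)) handshake
  ; degree≤edges = λ v → subst (_≤ N) (d≗d′ v) (degree≤edges v)
  ; degree+degree≤ = λ u v u≢v → subst₂ (λ x y → x + y ≤ suc N) (d≗d′ u) (d≗d′ v) (degree+degree≤ u v u≢v)
  ; ≤starBound = λ u → subst (λ x → M ≤ starBound N x) (d≗d′ u) (≤starBound u)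
  ; ≤tri = ≤tri }
  where open DegreeInvariants inv

graphInvariants : ∀ {n} (G : Graph n) → DegreeInvariants (degree G) (e G) (eL G)
graphInvariants {zero} G = emptyInvariants (degree G)
graphInvariants {suc n} G = invariants-cong degrees
  (trans (sym (e-extend H S)) (cong length (edges-extend-restrict G)))
  (trans (sym (eL-extend H S)) (cong (pairCount shareEndpoint) (edges-extend-restrict G)))
  (Extension.invariants S (degree H) (graphInvariants H))
  where
  H = restrict G
  S = neighboursOfZero G
  degrees : ∀ v → extendDegrees S (degree H) v ≡ degree G v
  degrees fzero = trans (sym (degree-extend-zero H S)) (cong (countTrue (incident fzero)) (edges-extend-restrict G))
  degrees (fsuc j) = trans (sym (degree-extend-suc H S j)) (cong (countTrue (incident (fsuc j))) (edges-extend-restrict G))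

-- With D = t + 2 + α and u = D + β the difference is exactly 1 + α β.
starBound<gapStart : ∀ t u D → t + 2 ≤ D → D ≤ u → starBound (u + t) D < tri u + tri (t + 2)
starBound<gapStart t u D t+2≤D D≤u with m≤n⇒∃[o]m+o≡n t+2≤D | m≤n⇒∃[o]m+o≡n D≤u
... | α , refl | β , refl = begin
  suc (starBound (t + 2 + α + β + t) (t + 2 + α))
    ≡⟨ cong (λ x → suc (tri (t + 2 + α) + tri x + 2 * x)) rest≡ ⟩
  suc (tri (t + 2 + α) + tri (β + t) + 2 * (β + t))
    ≤⟨ m≤m+n _ (α * β) ⟩
  suc (tri (t + 2 + α) + tri (β + t) + 2 * (β + t)) + α * β
    ≡⟨ cong (λ x → suc (tri (t + 2 + α) + x + 2 * (β + t)) + α * β) (tri-+ β t) ⟩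
  suc (tri (t + 2 + α) + (tri β + tri t + β * t) + 2 * (β + t)) + α * β
    ≡⟨ lemma (tri (t + 2 + α)) (tri β) (tri t) t α β ⟩
  tri (t + 2 + α) + tri β + (t + 2 + α) * β + (tri t + t + t + 1)
    ≡⟨ sym (cong₂ _+_ (tri-+ (t + 2 + α) β) (tri-+2 t)) ⟩
  tri (t + 2 + α + β) + tri (t + 2) ∎
  where
  open ≤-Reasoning
  rest≡ : t + 2 + α + β + t ∸ (t + 2 + α) ≡ β + t
  rest≡ = trans (cong (_∸ (t + 2 + α)) (+-assoc (t + 2 + α) β t)) (m+n∸m≡n (t + 2 + α) (β + t))
  lemma : ∀ TD Tβ Tt t α β →
    suc (TD + (Tβ + Tt + β * t) + 2 * (β + t)) + α * β ≡ TD + Tβ + (t + 2 + α) * β + (Tt + t + t + 1)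
  lemma = solve-∀

-- Σ deg² ≤ D Σ deg with D ≤ t + 1 gives M ≤ N t. A nonempty gap forces u > C(t+2,2), so
-- u = 2t + 2 + p with p ≥ C(t,2), and then C(u,2) + C(t+2,2) > N t.
lowMaxDegree-excluded : ∀ t u M → tri (t + 2) < u → tri u + tri (t + 2) ≤ M →
  M + M + (u + t) + (u + t) ≤ ((u + t) + (u + t)) * (t + 1) → ⊥
lowMaxDegree-excluded t u M tri<u gap sq with m≤n⇒∃[o]m+o≡n 2t+2+tri≤u
  where
  2t+2+tri≤u : t + t + 2 + tri t ≤ u
  2t+2+tri≤u = ≤-trans (≤-reflexive (trans (lemma t (tri t)) (cong suc (sym (tri-+2 t))))) tri<u
    where
    lemma : ∀ t T → t + t + 2 + T ≡ suc (T + t + t + 1)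
    lemma = solve-∀
... | q , refl = m+1+n≰m (X + (p + p + t)) (begin
  X + (p + p + t) + suc K ≡⟨ sym (identity t (tri t) q) ⟩
  A + t * t               ≤⟨ +-mono-≤ squares t*t≤p+p+t ⟩
  X + (p + p + t)         ∎)
  where
  open ≤-Reasoning
  p v N A X K : ℕ
  p = tri t + q
  v = t + t + 2 + tri t + q
  N = v + t
  A = v * v + (t + 2) * (t + 2) + (N + N)
  X = (N + N) * (t + 1) + v + (t + 2)
  K = p * p + 2 * t * p + p + 4 * t + 3
  identity : ∀ t T q → let p = T + q ; v = t + t + 2 + T + q ; N = v + t in
    v * v + (t + 2) * (t + 2) + (N + N) + t * t ≡
    (N + N) * (t + 1) + v + (t + 2) + (p + p + t) + suc (p * p + 2 * t * p + p + 4 * t + 3)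
  identity = solve-∀
  t*t≤p+p+t : t * t ≤ p + p + t
  t*t≤p+p+t = ≤-trans (≤-reflexive (sym (tri+tri+n≡n*n t)))
    (+-monoˡ-≤ t (+-mono-≤ (m≤m+n (tri t) q) (m≤m+n (tri t) q)))
  rearrange : ∀ a b x y z → a + a + x + (b + b + y) + z ≡ a + b + (a + b) + z + x + y
  rearrange = solve-∀
  squares : A ≤ X
  squares = begin
    v * v + (t + 2) * (t + 2) + (N + N)
      ≡⟨ cong₂ (λ a b → a + b + (N + N)) (sym (tri+tri+n≡n*n v)) (sym (tri+tri+n≡n*n (t + 2))) ⟩
    tri v + tri v + v + (tri (t + 2) + tri (t + 2) + (t + 2)) + (N + N)
      ≡⟨ rearrange (tri v) (tri (t + 2)) v (t + 2) (N + N) ⟩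
    tri v + tri (t + 2) + (tri v + tri (t + 2)) + (N + N) + v + (t + 2)
      ≤⟨ +-monoˡ-≤ (t + 2) (+-monoˡ-≤ v (+-monoˡ-≤ (N + N) (+-mono-≤ gap gap))) ⟩
    M + M + (N + N) + v + (t + 2)
      ≡⟨ cong (λ x → x + v + (t + 2)) (sym (+-assoc (M + M) N N)) ⟩
    M + M + N + N + v + (t + 2)
      ≤⟨ +-monoˡ-≤ (t + 2) (+-monoˡ-≤ v sq) ⟩
    X ∎

maxDegree-excludes-gap : ∀ u t M D → tri u + tri (t + 2) ≤ M → M < tri u + u → tri D ≤ M →
  M ≤ starBound (u + t) D → M + M + (u + t) + (u + t) ≤ ((u + t) + (u + t)) * D → ⊥
maxDegree-excludes-gap u t M D start end tri≤M M≤star sq with D ≤? u | t + 2 ≤? D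
... | no D≰u | _ = n≮n M (<-≤-trans end (≤-trans (tri-mono-≤ (≰⇒> D≰u)) tri≤M))
... | yes D≤u | yes t+2≤D = n≮n M (≤-<-trans M≤star (<-≤-trans (starBound<gapStart t u D t+2≤D D≤u) start))
... | yes _ | no t+2≰D = lowMaxDegree-excluded t u M
  (+-cancelˡ-< (tri u) (tri (t + 2)) u (≤-<-trans start end))
  start
  (≤-trans sq (*-monoʳ-≤ ((u + t) + (u + t)) (≤-pred (≤-trans (≰⇒> t+2≰D) (≤-reflexive (+-suc t 1))))))

argmax : ∀ {n} (f : Fin (suc n) → ℕ) → Σ (Fin (suc n)) (λ c → ∀ v → f v ≤ f c)
argmax {zero} f = fzero , λ { fzero → ≤-refl }
argmax {suc n} f with argmax (f ∘ fsuc)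
... | c , f≤fc with f fzero ≤? f (fsuc c)
...   | yes f0≤ = fsuc c , λ { fzero → f0≤ ; (fsuc v) → f≤fc v }
...   | no f0≰ = fzero , λ { fzero → ≤-refl ; (fsuc v) → ≤-trans (f≤fc v) (<⇒≤ (≰⇒> f0≰)) }

sumSquares≤ : ∀ {n} {d : Fin n → ℕ} {N M D} → DegreeInvariants d N M → (∀ v → d v ≤ D) →
  M + M + N + N ≤ (N + N) * D
sumSquares≤ {d = d} {N} {M} {D} inv d≤D = begin
  M + M + N + N                           ≡⟨ +-assoc (M + M) N N ⟩
  M + M + (N + N)                         ≡⟨ cong₂ (λ m x → m + m + x) lineEdges (sym handshake) ⟩
  sum (tri ∘ d) + sum (tri ∘ d) + sum d   ≡⟨ cong (_+ sum d) (sym (∑-distrib-+ (tri ∘ d) (tri ∘ d))) ⟩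
  sum (λ v → tri (d v) + tri (d v)) + sum d ≡⟨ sym (∑-distrib-+ (λ v → tri (d v) + tri (d v)) d) ⟩
  sum (λ v → tri (d v) + tri (d v) + d v) ≡⟨ sum-cong-≗ (tri+tri+n≡n*n ∘ d) ⟩
  sum (λ v → d v * d v)                   ≤⟨ sum-mono-≤ (λ v → *-monoʳ-≤ (d v) (d≤D v)) ⟩
  sum (λ v → d v * D)                     ≡⟨ sym (*-distribʳ-sum D d) ⟩
  sum d * D                               ≡⟨ cong (_* D) handshake ⟩
  (N + N) * D                             ∎
  where
  open ≤-Reasoning
  open DegreeInvariants inv

gap-infeasible : ∀ N M t → inGap N M t → ¬ Feasible N M
gap-infeasible N M t (start , end) (zero , G , eG , refl) =
  n≮0 (≤-trans 1≤[t+2]C2 (≤-trans (m≤n+m ((t + 2) C 2) ((N ∸ t) C 2)) start))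
  where
  1≤[t+2]C2 : 1 ≤ (t + 2) C 2
  1≤[t+2]C2 = ≤-trans (m≤n+m 1 (tri t + t + t)) (≤-reflexive (sym (trans (nC2≡tri (t + 2)) (tri-+2 t))))
gap-infeasible N M t (start , end) (suc n , G , refl , refl) with t ≤? N
... | no t≰N = n≮0 (≤-trans (m≤n+m 1 M) (≤-trans end (≤-reflexive (cong (λ x → (x + 1) C 2) (m≤n⇒m∸n≡0 (<⇒≤ (≰⇒> t≰N)))))))
... | yes t≤N = maxDegree-excludes-gap u t M D start′ end′ (≤-trans (≤-sum (tri ∘ d) c) (≤-reflexive (sym lineEdges)))
  (subst (λ x → M ≤ starBound x D) N≡u+t (≤starBound c))
  (subst (λ x → M + M + x + x ≤ (x + x) * D) N≡u+t (sumSquares≤ inv (proj₂ (argmax d))))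
  where
  inv : DegreeInvariants (degree G) N M
  inv = graphInvariants G
  open DegreeInvariants inv
  d : Fin (suc n) → ℕ
  d = degree G
  c : Fin (suc n)
  c = proj₁ (argmax d)
  D u : ℕ
  D = d c
  u = N ∸ t
  N≡u+t : N ≡ u + t
  N≡u+t = sym (m∸n+n≡m t≤N)
  start′ : tri u + tri (t + 2) ≤ M
  start′ = subst₂ (λ a b → a + b ≤ M) (nC2≡tri u) (nC2≡tri (t + 2)) start
  end′ : M < tri u + u
  end′ = ≤-trans (≤-reflexive (+-comm 1 M)) (≤-trans end (≤-reflexive (trans (nC2≡tri (u + 1)) (tri-+1 u))))

-- Constructions

prefix : ∀ {n} → ℕ → Fin n → Bool
prefix zero _ = false
prefix (suc k) fzero = true
prefix (suc k) (fsuc j) = prefix k j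

sumPrefix : ∀ {n} → ℕ → Vec ℕ n → ℕ
sumPrefix zero _ = 0
sumPrefix (suc k) [] = 0
sumPrefix (suc k) (x ∷ xs) = x + sumPrefix k xs

incPrefix : ∀ {n} → ℕ → Vec ℕ n → Vec ℕ n
incPrefix zero xs = xs
incPrefix (suc k) [] = []
incPrefix (suc k) (x ∷ xs) = suc x ∷ incPrefix k xs

count-prefix : ∀ {n} k → k ≤ n → count (prefix {n} k) ≡ k
count-prefix {zero} zero _ = refl
count-prefix {suc n} zero _ = count-prefix {n} zero z≤n
count-prefix {suc n} (suc k) (s≤s k≤n) = cong suc (count-prefix k k≤n)

sumOver-prefix : ∀ {n} k (xs : Vec ℕ n) → sumOver (prefix k) (lookup xs) ≡ sumPrefix k xs
sumOver-prefix zero [] = refl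
sumOver-prefix zero (x ∷ xs) = sumOver-prefix zero xs
sumOver-prefix (suc k) [] = refl
sumOver-prefix (suc k) (x ∷ xs) = cong (x +_) (sumOver-prefix k xs)

bit-prefix+lookup : ∀ {n} k (xs : Vec ℕ n) j → bit (prefix k j) + lookup xs j ≡ lookup (incPrefix k xs) j
bit-prefix+lookup zero xs j = refl
bit-prefix+lookup (suc k) (x ∷ xs) fzero = refl
bit-prefix+lookup (suc k) (x ∷ xs) (fsuc j) = bit-prefix+lookup k xs j

sumPrefix-replicate : ∀ {n} r k c (xs : Vec ℕ n) → sumPrefix (r + k) (replicate r c ++ᵛ xs) ≡ r * c + sumPrefix k xs
sumPrefix-replicate zero k c xs = refl
sumPrefix-replicate (suc r) k c xs = trans (cong (c +_) (sumPrefix-replicate r k c xs)) (sym (+-assoc c (r * c) _))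

sumPrefix-replicate-≤ : ∀ {n} r s c (xs : Vec ℕ n) → s ≤ r → sumPrefix s (replicate r c ++ᵛ xs) ≡ s * c
sumPrefix-replicate-≤ r zero c xs _ = refl
sumPrefix-replicate-≤ (suc r) (suc s) c xs (s≤s s≤r) = cong (c +_) (sumPrefix-replicate-≤ r s c xs s≤r)

incPrefix-replicate : ∀ {n} r c (xs : Vec ℕ n) → incPrefix r (replicate r c ++ᵛ xs) ≡ replicate r (suc c) ++ᵛ xs
incPrefix-replicate zero c xs = refl
incPrefix-replicate (suc r) c xs = cong (suc c ∷_) (incPrefix-replicate r c xs)

record GraphWith (n : ℕ) (ds : Vec ℕ n) (N M : ℕ) : Set where
  field
    graph : Graph n
    edges≡ : e graph ≡ N
    lineEdges≡ : eL graph ≡ M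
    degrees≡ : ∀ v → degree graph v ≡ lookup ds v

feasible : ∀ {n ds N M} → GraphWith n ds N M → Feasible N M
feasible {n} G = n , graph , edges≡ , lineEdges≡
  where open GraphWith G

edgeless : GraphWith 0 [] 0 0
edgeless = record { graph = record { adj = λ () ; symm = λ () ; irrefl = λ () }
  ; edges≡ = refl ; lineEdges≡ = refl ; degrees≡ = λ () }

addHub : ∀ {n ds N M} k → k ≤ n → GraphWith n ds N M →
  GraphWith (suc n) (k ∷ incPrefix k ds) (k + N) (tri k + M + sumPrefix k ds)
addHub {ds = ds} k k≤n G = record
  { graph = extend graph (prefix k)
  ; edges≡ = trans (e-extend graph (prefix k)) (cong₂ _+_ (count-prefix k k≤n) edges≡)
  ; lineEdges≡ = trans (eL-extend graph (prefix k))
      (cong₂ _+_ (cong₂ _+_ (cong tri (count-prefix k k≤n)) lineEdges≡)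
                 (trans (sumOver-cong (prefix k) degrees≡) (sumOver-prefix k ds)))
  ; degrees≡ = λ { fzero → trans (degree-extend-zero graph (prefix k)) (count-prefix k k≤n)
                 ; (fsuc j) → trans (degree-extend-suc graph (prefix k) j)
                                    (trans (cong (bit (prefix k j) +_) (degrees≡ j)) (bit-prefix+lookup k ds j)) } }
  where
  open GraphWith G

GraphWith-cong : ∀ {n ds ds′ N N′ M M′} → ds ≡ ds′ → N ≡ N′ → M ≡ M′ → GraphWith n ds N M → GraphWith n ds′ N′ M′
GraphWith-cong refl refl refl G = G

addIsolated : ∀ {n ds N M} f → GraphWith n ds N M → GraphWith (f + n) (replicate f 0 ++ᵛ ds) N M
addIsolated zero G = G
addIsolated (suc f) G = GraphWith-cong refl refl (+-identityʳ _) (addHub 0 z≤n (addIsolated f G))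

twice : ℕ → ℕ
twice zero = 0
twice (suc m) = suc (suc (twice m))

twice≡2* : ∀ m → twice m ≡ 2 * m
twice≡2* zero = refl
twice≡2* (suc m) = trans (cong (2 +_) (twice≡2* m)) (sym (*-suc 2 m))

addMatching : ∀ {n ds N M} m → GraphWith n ds N M → GraphWith (twice m + n) (replicate (twice m) 1 ++ᵛ ds) (m + N) M
addMatching zero G = G
addMatching (suc m) G =
  GraphWith-cong refl refl (trans (+-identityʳ _) (+-identityʳ _)) (addHub 1 (s≤s z≤n) (addHub 0 z≤n (addMatching m G)))

star : ∀ j → GraphWith (suc (j + 0)) (j ∷ replicate j 1 ++ᵛ []) j (tri j)
star j = GraphWith-cong (cong (j ∷_) (incPrefix-replicate j 0 [])) (+-identityʳ j) tri-eq
  (addHub j (m≤m+n j 0) (addIsolated j edgeless))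
  where
  tri-eq : tri j + 0 + sumPrefix j (replicate j 0 ++ᵛ []) ≡ tri j
  tri-eq = trans (cong₂ _+_ (+-identityʳ (tri j)) (trans (sumPrefix-replicate-≤ j j 0 [] ≤-refl) (*-zeroʳ j))) (+-identityʳ (tri j))

-- The vertices are f isolated ones, the 2m of a matching, then the centre and the j leaves
-- of a star, in this order; the hub is joined to the first k of them.
starMatchingHub : ∀ f m j k → k ≤ f + (twice m + suc (j + 0)) →
  Feasible (k + (m + j)) (tri k + tri j + sumPrefix k (replicate f 0 ++ᵛ (replicate (twice m) 1 ++ᵛ (j ∷ replicate j 1 ++ᵛ []))))
starMatchingHub f m j k k≤ = feasible (addHub k k≤ (addIsolated f (addMatching m (star j))))

feasible-cong : ∀ {N N′ M M′} → N ≡ N′ → M ≡ M′ → Feasible N M → Feasible N′ M′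
feasible-cong refl refl F = F

matchingHub : ∀ f m s → s ≤ twice m → Feasible ((f + s) + m) (tri (f + s) + s)
matchingHub f m s s≤2m = feasible-cong (cong ((f + s) +_) (+-identityʳ m)) M≡
  (starMatchingHub f m 0 (f + s) (+-monoʳ-≤ f (≤-trans s≤2m (m≤m+n (twice m) 1))))
  where
  M≡ : tri (f + s) + 0 + sumPrefix (f + s) (replicate f 0 ++ᵛ (replicate (twice m) 1 ++ᵛ (0 ∷ []))) ≡ tri (f + s) + s
  M≡ = cong₂ _+_ (+-identityʳ _) (begin
    sumPrefix (f + s) (replicate f 0 ++ᵛ (replicate (twice m) 1 ++ᵛ (0 ∷ [])))
      ≡⟨ sumPrefix-replicate f s 0 _ ⟩
    f * 0 + sumPrefix s (replicate (twice m) 1 ++ᵛ (0 ∷ []))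
      ≡⟨ cong₂ _+_ (*-zeroʳ f) (sumPrefix-replicate-≤ (twice m) s 1 (0 ∷ []) s≤2m) ⟩
    s * 1
      ≡⟨ *-identityʳ s ⟩
    s ∎)
    where open ≡-Reasoning

starHub : ∀ f m j x → x ≤ j →
  Feasible ((f + (twice m + suc x)) + (m + j)) (tri (f + (twice m + suc x)) + tri j + (twice m + (j + x)))
starHub f m j x x≤j = feasible-cong refl (cong (tri k + tri j +_) sum≡)
  (starMatchingHub f m j k (+-monoʳ-≤ f (+-monoʳ-≤ (twice m) (s≤s (≤-trans x≤j (m≤m+n j 0))))))
  where
  k = f + (twice m + suc x)
  sum≡ : sumPrefix k (replicate f 0 ++ᵛ (replicate (twice m) 1 ++ᵛ (j ∷ replicate j 1 ++ᵛ []))) ≡ twice m + (j + x)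
  sum≡ = begin
    sumPrefix k (replicate f 0 ++ᵛ (replicate (twice m) 1 ++ᵛ (j ∷ replicate j 1 ++ᵛ [])))
      ≡⟨ sumPrefix-replicate f (twice m + suc x) 0 _ ⟩
    f * 0 + sumPrefix (twice m + suc x) (replicate (twice m) 1 ++ᵛ (j ∷ replicate j 1 ++ᵛ []))
      ≡⟨ cong₂ _+_ (*-zeroʳ f) (sumPrefix-replicate (twice m) (suc x) 1 _) ⟩
    twice m * 1 + (j + sumPrefix x (replicate j 1 ++ᵛ []))
      ≡⟨ cong₂ (λ a b → a + (j + b)) (*-identityʳ (twice m)) (trans (sumPrefix-replicate-≤ j x 1 [] x≤j) (*-identityʳ x)) ⟩
    twice m + (j + x) ∎
    where open ≡-Reasoning

triRoot : ∀ M K → M < tri (suc K) → ∃[ D ] (D ≤ K × tri D ≤ M × M < tri (suc D))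
triRoot M zero ()
triRoot M (suc K) M<tri with M <? tri (suc K)
... | yes M<tri′ with triRoot M K M<tri′
...   | D , D≤K , tri≤M , M<tri″ = D , m≤n⇒m≤1+n D≤K , tri≤M , M<tri″
triRoot M (suc K) M<tri | no M≮tri = suc K , ≤-refl , ≮⇒≥ M≮tri , M<tri

smallExcess-feasible : ∀ D t r → r ≤ D → r ≤ 2 * t → Feasible (D + t) (tri D + r)
smallExcess-feasible D t r r≤D r≤2t = feasible-cong (cong (_+ t) D∸r+r≡D) (cong (λ x → tri x + r) D∸r+r≡D)
  (matchingHub (D ∸ r) t r (≤-trans r≤2t (≤-reflexive (sym (twice≡2* t)))))
  where
  D∸r+r≡D : D ∸ r + r ≡ D
  D∸r+r≡D = m∸n+n≡m r≤D

largeExcess-feasible : ∀ D K q → suc (2 * suc K) + q < D → q < tri (suc K) →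
  Feasible (D + suc K) (tri D + (suc (2 * suc K) + q))
largeExcess-feasible D K q r<D q<tri with triRoot q K q<tri
... | J , J≤K , triJ≤q , q<triJ+J with m≤n⇒∃[o]m+o≡n triJ≤q | m≤n⇒∃[o]m+o≡n J≤K
... | y , refl | z , refl = feasible-cong N≡ M≡ (starHub f z (suc J) x (s≤s y<J))
  where
  x used f : ℕ
  x = suc (suc y)
  y<J : y < J
  y<J = +-cancelˡ-< (tri J) y J q<triJ+J
  used = twice z + suc x
  used≤D : used ≤ D
  used≤D = ≤-trans (≤-trans (m≤m+n used (J + J + tri J)) (≤-reflexive (room-eq)) ) (<⇒≤ r<D)
    where
    room-eq : used + (J + J + tri J) ≡ suc (2 * suc (J + z)) + (tri J + y)
    room-eq = trans (cong (λ w → w + suc x + (J + J + tri J)) (twice≡2* z)) (lemma z y J (tri J))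
      where
      lemma : ∀ z y J T → 2 * z + suc (suc (suc y)) + (J + J + T) ≡ suc (2 * suc (J + z)) + (T + y)
      lemma = solve-∀
  f = D ∸ used
  f+used≡D : f + used ≡ D
  f+used≡D = m∸n+n≡m used≤D
  N≡ : f + used + (z + suc J) ≡ D + suc (J + z)
  N≡ = cong₂ _+_ f+used≡D (trans (+-suc z J) (cong suc (+-comm z J)))
  M≡ : tri (f + used) + tri (suc J) + (twice z + (suc J + x)) ≡ tri D + (suc (2 * suc (J + z)) + (tri J + y))
  M≡ = begin
    tri (f + used) + tri (suc J) + (twice z + (suc J + x)) ≡⟨ cong (λ w → tri w + tri (suc J) + (twice z + (suc J + x))) f+used≡D ⟩
    tri D + tri (suc J) + (twice z + (suc J + x))         ≡⟨ +-assoc (tri D) _ _ ⟩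
    tri D + (tri J + J + (twice z + (suc J + x)))          ≡⟨ cong (λ w → tri D + (tri J + J + (w + (suc J + x)))) (twice≡2* z) ⟩
    tri D + (tri J + J + (2 * z + (suc J + x)))            ≡⟨ cong (tri D +_) (lemma z y J (tri J)) ⟩
    tri D + (suc (2 * suc (J + z)) + (tri J + y))          ∎
    where
    open ≡-Reasoning
    lemma : ∀ z y J T → T + J + (2 * z + (suc J + suc (suc y))) ≡ suc (2 * suc (J + z)) + (T + y)
    lemma = solve-∀

room⇒tBound : ∀ D t → tri t + 2 * t + 2 ≤ D → tBound (D + t) t
room⇒tBound D t room with m≤n⇒∃[o]m+o≡n room
... | w , refl = begin
  suc ((2 * t + 5) * (2 * t + 5))                     ≡⟨ lemma₁ t ⟩
  4 * (t * t) + 20 * t + 26                          ≡⟨ cong (λ x → 4 * x + 20 * t + 26) (sym (tri+tri+n≡n*n t)) ⟩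
  4 * (tri t + tri t + t) + 20 * t + 26               ≤⟨ m≤m+n _ (7 + 8 * w) ⟩
  4 * (tri t + tri t + t) + 20 * t + 26 + (7 + 8 * w) ≡⟨ lemma₂ (tri t) t w ⟩
  8 * (tri t + 2 * t + 2 + w + t) + 17                ∎
  where
  open ≤-Reasoning
  lemma₁ : ∀ t → suc ((2 * t + 5) * (2 * t + 5)) ≡ 4 * (t * t) + 20 * t + 26
  lemma₁ = solve-∀
  lemma₂ : ∀ T t w → 4 * (T + T + t) + 20 * t + 26 + (7 + 8 * w) ≡ 8 * (T + 2 * t + 2 + w + t) + 17
  lemma₂ = solve-∀

excess-gap : ∀ D t r → tri t + 2 * t < r → r < D → tri D + r ≤ tri (D + t) →
  (1 ≤ t) × tBound (D + t) t × inGap (D + t) (tri D + r) t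
excess-gap D zero r 0<r _ M≤ =
  ⊥-elim (m+1+n≰m (tri D) (≤-trans (+-monoʳ-≤ (tri D) 0<r) (≤-trans M≤ (≤-reflexive (cong tri (+-identityʳ D))))))
excess-gap D t@(suc _) r lt r<D _ = s≤s z≤n , room⇒tBound D t room , start , end
  where
  room : tri t + 2 * t + 2 ≤ D
  room = ≤-trans (≤-reflexive (+-comm _ 2)) (≤-trans (s≤s lt) r<D)
  start : (D + t ∸ t) C 2 + (t + 2) C 2 ≤ tri D + r
  start = begin
    (D + t ∸ t) C 2 + (t + 2) C 2 ≡⟨ cong₂ _+_ (trans (cong (_C 2) (m+n∸n≡m D t)) (nC2≡tri D)) (trans (nC2≡tri (t + 2)) (tri-+2 t)) ⟩
    tri D + (tri t + t + t + 1)   ≡⟨ cong (tri D +_) (lemma (tri t) t) ⟩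
    tri D + suc (tri t + 2 * t)   ≤⟨ +-monoʳ-≤ (tri D) lt ⟩
    tri D + r                     ∎
    where
    open ≤-Reasoning
    lemma : ∀ T t → T + t + t + 1 ≡ suc (T + 2 * t)
    lemma = solve-∀
  end : tri D + r + 1 ≤ (D + t ∸ t + 1) C 2
  end = begin
    tri D + r + 1           ≡⟨ trans (+-assoc (tri D) r 1) (cong (tri D +_) (+-comm r 1)) ⟩
    tri D + suc r           ≤⟨ +-monoʳ-≤ (tri D) r<D ⟩
    tri D + D               ≡⟨ sym (trans (cong (λ x → (x + 1) C 2) (m+n∸n≡m D t)) (trans (nC2≡tri (D + 1)) (tri-+1 D))) ⟩
    (D + t ∸ t + 1) C 2     ∎
    where open ≤-Reasoning

infeasible-in-gap-at : ∀ {N M} D t r → N ≡ D + t → M ≡ tri D + r → r < D → M ≤ tri N → ¬ Feasible N M →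
  ∃[ s ] ((1 ≤ s) × tBound N s × inGap N M s)
infeasible-in-gap-at D t r refl refl r<D M≤ infeasible with tri t + 2 * t <? r
... | yes lt = t , excess-gap D t r lt r<D M≤
... | no r≮ with r ≤? 2 * t
...   | yes r≤2t = ⊥-elim (infeasible (smallExcess-feasible D t r (<⇒≤ r<D) r≤2t))
infeasible-in-gap-at D zero r refl refl r<D M≤ infeasible | no r≮ | no r≰0 = ⊥-elim (r≰0 (≮⇒≥ r≮))
infeasible-in-gap-at D (suc K) r refl refl r<D M≤ infeasible | no r≮ | no r≰2t with m≤n⇒∃[o]m+o≡n (≰⇒> r≰2t)
... | q , refl = ⊥-elim (infeasible (largeExcess-feasible D K q r<D q<tri))
  where
  q<tri : q < tri (suc K)
  q<tri = +-cancelˡ-< (suc (2 * suc K)) q (tri (suc K))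
    (≤-trans (s≤s (≮⇒≥ r≮)) (≤-reflexive (cong suc (+-comm (tri (suc K)) (2 * suc K)))))

infeasible-in-gap : ∀ N M → M ≤ N C 2 → ¬ Feasible N M → ∃[ t ] ((1 ≤ t) × tBound N t × inGap N M t)
infeasible-in-gap zero zero _ infeasible = ⊥-elim (infeasible (feasible edgeless))
infeasible-in-gap (suc n) M M≤ infeasible = decompose (triRoot M (suc n) (≤-<-trans M≤tri (m<m+n (tri (suc n)) (s≤s z≤n))))
  where
  M≤tri : M ≤ tri (suc n)
  M≤tri = ≤-trans M≤ (≤-reflexive (nC2≡tri (suc n)))
  decompose : ∃[ D ] (D ≤ suc n × tri D ≤ M × M < tri (suc D)) → ∃[ t ] ((1 ≤ t) × tBound (suc n) t × inGap (suc n) M t)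
  decompose (D , D≤N , triD≤M , M<triD+D) with m≤n⇒∃[o]m+o≡n triD≤M | m≤n⇒∃[o]m+o≡n D≤N
  ... | r , M≡ | t , N≡ = infeasible-in-gap-at D t r (sym N≡) (sym M≡)
    (+-cancelˡ-< (tri D) r D (subst (_< tri D + D) (sym M≡) M<triD+D)) M≤tri infeasible

theorem1 : (N M : ℕ) → 5 ≤ N → M ≤ N C 2 →
    ((¬ Feasible N M) ⇔ (∃[ t ] ((1 ≤ t) × tBound N t × inGap N M t)))
theorem1 N M _ M≤ = mk⇔ (infeasible-in-gap N M M≤) (λ { (t , _ , _ , gap) → gap-infeasible N M t gap })
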